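{- Let $d\geq 2$ be an integer and let $n$ and $k$ be positive integers such that $n<d^{k+1}$. Then the number $p_d(n)$ of $d$-ary partitions of $n$ is $$p_d(n)=\frac{1}{k!} \sum_{\substack{0\leq j_1\leq d^{k}-1,\; 0\leq j_2\leq d^{k-1}-1,\; \ldots,\; 0\leq j_{k} \leq d-1 \\ j_1+j_2d+\cdots+j_kd^{k-1} \equiv n \pmod{d^k}}} \prod_{\ell=1}^{k} \left(\frac{n-j_{1}- j_2 d- \cdots -j_k d^{k-1}}{d^k}+\ell \right),$$ where the sum runs over integer tuples $(j_1,\ldots,j_k)$ with $0\leq j_i\leq d^{k+1-i}-1$ for $1\leq i\leq k$.
   Context: A partition of a positive integer $n$ is a non-increasing sequence of positive integers (its parts) summing to $n$. For an integer $d\geq 2$, a partition is $d$-ary if all of its parts are powers of $d$ (including $d^0=1$). $p_d(n)$ denotes the number of $d$-ary partitions of $n$. -}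

module Defs where

open import Data.Nat as ℕ using (ℕ; zero; suc; _^_; _≤_; _∸_; _!)
import Data.Nat.Properties as ℕP
open import Data.Integer as ℤ using (ℤ; +_)
open import Data.Integer.DivMod using (_/ℕ_)
open import Data.List using (List; []; _∷_; map; concatMap; upTo; filter; foldr; length)
open import Data.List.Relation.Unary.All using (All)
open import Data.List.Relation.Unary.Linked using (Linked)
open import Data.List.Membership.Propositional using (_∈_)
open import Data.List.Relation.Unary.Unique.Propositional using (Unique)
open import Data.Product using (Σ; ∃; _×_)
open import Relation.Binary.PropositionalEquality using (_≡_)
open import Function.Bundles using (_⇔_)
open import Data.Nat using (_≟_)

sumℕ : List ℕ → ℕ
sumℕ = foldr ℕ._+_ 0

IsPowerOf : ℕ → ℕ → Set
IsPowerOf d x = ∃ λ e → x ≡ d ^ e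

IsPartition : ℕ → List ℕ → Set
IsPartition n λs = Linked ℕ._≥_ λs × All (λ x → 1 ≤ x) λs × sumℕ λs ≡ n

IsDAryPartition : ℕ → ℕ → List ℕ → Set
IsDAryPartition d n λs = IsPartition n λs × All (IsPowerOf d) λs

-- "p_d(n) = c": c is the number of d-ary partitions of n, i.e. there is a
-- duplicate-free list enumerating exactly the d-ary partitions of n, of length c.
HasDAryCount : ℕ → ℕ → ℕ → Set
HasDAryCount d n c =
  Σ (List (List ℕ)) λ L →
    ((λs : List ℕ) → (λs ∈ L) ⇔ IsDAryPartition d n λs) × Unique L × length L ≡ c

tuples : List ℕ → List (List ℕ)
tuples []       = [] ∷ []
tuples (b ∷ bs) = concatMap (λ j → map (j ∷_) (tuples bs)) (upTo b)

-- bounds d^k, d^(k-1), ..., d   (i.e. j_i ≤ d^(k+1-i) - 1 for i = 1..k)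
bounds : ℕ → ℕ → List ℕ
bounds d k = map (λ i → d ^ (k ∸ i)) (upTo k)

weighted : ℕ → List ℕ → ℕ
weighted d []       = 0
weighted d (j ∷ js) = j ℕ.+ d ℕ.* weighted d js

sumℤ : List ℤ → ℤ
sumℤ = foldr ℤ._+_ (+ 0)

prodℤ : List ℤ → ℤ
prodℤ = foldr ℤ._*_ (+ 1)

-- for d ≥ 2:
--   Σ_{tuples with J ≡ n mod d^k}  Π_{ℓ=1}^{k} ((n - J)/d^k + ℓ)
-- (the division is exact on the summation range because of the congruence)
rhsSum : (d k n : ℕ) → 2 ≤ d → ℤ
rhsSum d k n h = sumℤ (map term admissible)
  where
  instance
    dnz : ℕ.NonZero d
    dnz = ℕ.>-nonZero (ℕP.<-trans (ℕ.s≤s ℕ.z≤n) h)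
    dknz : ℕ.NonZero (d ^ k)
    dknz = ℕP.m^n≢0 d k
  admissible : List (List ℕ)
  admissible = filter (λ js → ℕ._%_ (weighted d js) (d ^ k) ≟ ℕ._%_ n (d ^ k)) (tuples (bounds d k))
  term : List ℕ → ℤ
  term js = prodℤ (map (λ ℓ → ((+ n ℤ.- + weighted d js) /ℕ (d ^ k)) ℤ.+ + ℓ) (map suc (upTo k)))

module Submission where

-- Let N_k(n) count the d-ary partitions of n whose parts are at most d^k. Removing the parts
-- equal to 1 and dividing the others by d gives N_0(n) = 1 and N_{k+1}(n) = Σ_{c ≤ n/d} N_k(c),
-- and N_k(n) = p_d(n) when n < d^{k+1}. By induction on k, N_k(n) is the sum of
-- C((n - J)/d^k + k, k) over the digit tuples of weight J ≤ n with J ≡ n (mod d^k): the sum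
-- over c is a hockey-stick sum inside a residue class, and the new digit j_1 is forced to be
-- the residue of n - d·J' modulo d^{k+1}. Finally k!·C(q + k, k) = (q + 1)⋯(q + k), and a tuple
-- with J > n adds nothing to the formula, because then (n - J)/d^k = -t with 1 ≤ t ≤ k.

open import Defs

module DAryPartitions where

  open import Data.Bool using (if_then_else_)
  open import Data.Empty.Irrelevant using (⊥-elim)
  open import Data.List
    using (List; []; _∷_; map; upTo; applyUpTo; concatMap; _++_; filter; replicate; takeWhile; dropWhile; length; head)
  open import Data.List.Properties
    using (map-++; map-∘; map-cong; map-id-local; upTo-∷ʳ; map-upTo; map-applyUpTo; takeWhile++dropWhile; length-++; length-map)
  open import Data.List.Membership.Propositional using (_∈_; find; lose)
  open import Data.List.Membership.Propositional.Properties
    using (∈-map⁺; ∈-map⁻; ∈-upTo⁺; ∈-upTo⁻; ∈-concatMap⁻; ∈-concatMap⁺)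
  open import Data.List.Relation.Binary.Disjoint.Propositional using (Disjoint)
  open import Data.List.Relation.Unary.All as All using (All; []; _∷_)
  import Data.List.Relation.Unary.All.Properties as All
  open import Data.List.Relation.Unary.AllPairs using ([]; _∷_)
  open import Data.List.Relation.Unary.Any using (here; there)
  open import Data.List.Relation.Unary.Linked as Linked using (Linked; []; [-]; _∷_)
  import Data.List.Relation.Unary.Linked.Properties as Linked
  open import Data.List.Relation.Unary.Unique.Propositional using (Unique)
  import Data.List.Relation.Unary.Unique.Propositional.Properties as Unique
  open import Data.Maybe.Relation.Unary.All as Maybe using (just)
  open import Data.Nat
    using (ℕ; zero; suc; _+_; _*_; _∸_; _^_; _≤_; _<_; _≥_; _!; s≤s; s≤s⁻¹; z≤n; _≟_; _≤?_; _/_; _%_; NonZero; >-nonZero)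
  open import Data.Nat.DivMod
  open import Data.Nat.Divisibility using (_∣_; _∤_; _∣?_; divides; _∣0; 1∣_; n∣m*n; n∣m⇒m%n≡0)
  open import Data.Nat.ListAction using (sum)
  open import Data.Nat.ListAction.Properties using (sum-++)
  open import Data.Nat.Properties
  open import Algebra.Properties.CommutativeSemigroup +-commutativeSemigroup using (interchange)
  open import Data.Product using (_×_; _,_; ∃₂; proj₁; proj₂)
  open import Data.Sum using (_⊎_; inj₁; inj₂)
  open import Function using (_∘_)
  open import Function.Bundles using (_⇔_; mk⇔)
  open import Level using (Level)
  open import Relation.Binary.PropositionalEquality
  open import Relation.Nullary using (Dec; yes; no; does; ¬_; contradiction)
  open import Relation.Nullary.Decidable using (dec-true; dec-false)
  open import Relation.Unary using (Decidable; ∁)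

  private
    variable
      a : Level
      A B : Set a

  when : Dec A → ℕ → ℕ
  when p x = if does p then x else 0

  module _ (p : Dec A) {x : ℕ} where

    when-yes : A → when p x ≡ x
    when-yes a rewrite dec-true p a = refl

    when-no : ¬ A → when p x ≡ 0
    when-no ¬a rewrite dec-false p ¬a = refl

  when-≡0 : ∀ {x} (p : Dec A) → (A → x ≡ 0) → when p x ≡ 0
  when-≡0 (yes a) x≡0 = x≡0 a
  when-≡0 (no _)  _   = refl

  when-cong : ∀ {b} {B : Set b} {x y} (p : Dec A) (q : Dec B) →
              (A → B) → (B → A) → (A → x ≡ y) → when p x ≡ when q y
  when-cong (yes a) (yes b) _   _   x≡y = x≡y a
  when-cong (yes a) (no ¬b) A→B _   _   = contradiction (A→B a) ¬b
  when-cong (no ¬a) (yes b) _   B→A _   = contradiction (B→A b) ¬a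
  when-cong (no _)  (no _)  _   _   _   = refl

  sumBelow : (ℕ → ℕ) → ℕ → ℕ
  sumBelow f zero    = 0
  sumBelow f (suc n) = sumBelow f n + f n

  sumBelow-cong : ∀ {f g} n → (∀ i → i < n → f i ≡ g i) → sumBelow f n ≡ sumBelow g n
  sumBelow-cong zero    f≡g = refl
  sumBelow-cong (suc n) f≡g = cong₂ _+_ (sumBelow-cong n (λ i i<n → f≡g i (m<n⇒m<1+n i<n))) (f≡g n ≤-refl)

  sumBelow-zero : ∀ {f} n → (∀ i → i < n → f i ≡ 0) → sumBelow f n ≡ 0
  sumBelow-zero n f≡0 = trans (sumBelow-cong n f≡0) (sumBelow-0 n)
    where
    sumBelow-0 : ∀ n → sumBelow (λ _ → 0) n ≡ 0
    sumBelow-0 zero    = refl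
    sumBelow-0 (suc n) = cong (_+ 0) (sumBelow-0 n)

  sumBelow-single : ∀ {f} n j → j < n → (∀ i → i < n → i ≢ j → f i ≡ 0) → sumBelow f n ≡ f j
  sumBelow-single {f} (suc n) j (s≤s j≤n) f≡0 with m≤n⇒m<n∨m≡n j≤n
  ... | inj₁ j<n = trans (cong₂ _+_ (sumBelow-single n j j<n (λ i i<n → f≡0 i (m<n⇒m<1+n i<n)))
                                    (f≡0 n ≤-refl (λ n≡j → <-irrefl (sym n≡j) j<n)))
                          (+-identityʳ _)
  ... | inj₂ refl = cong (_+ f n) (sumBelow-zero n (λ i i<n → f≡0 i (m<n⇒m<1+n i<n) (<⇒≢ i<n)))

  sumBelow-+ : ∀ f g n → sumBelow (λ i → f i + g i) n ≡ sumBelow f n + sumBelow g n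
  sumBelow-+ f g zero    = refl
  sumBelow-+ f g (suc n) = trans (cong (_+ (f n + g n)) (sumBelow-+ f g n)) (interchange (sumBelow f n) (sumBelow g n) (f n) (g n))

  sumBelow-* : ∀ c f n → sumBelow (λ i → c * f i) n ≡ c * sumBelow f n
  sumBelow-* c f zero    = sym (*-zeroʳ c)
  sumBelow-* c f (suc n) = trans (cong (_+ c * f n) (sumBelow-* c f n)) (sym (*-distribˡ-+ c _ (f n)))

  sumList : (A → ℕ) → List A → ℕ
  sumList f = sum ∘ map f

  sumList-++ : ∀ (f : A → ℕ) xs ys → sumList f (xs ++ ys) ≡ sumList f xs + sumList f ys
  sumList-++ f xs ys = trans (cong sum (map-++ f xs ys)) (sum-++ (map f xs) (map f ys))

  sumList-* : ∀ c (f : A → ℕ) xs → sumList (λ x → c * f x) xs ≡ c * sumList f xs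
  sumList-* c f []       = sym (*-zeroʳ c)
  sumList-* c f (x ∷ xs) = trans (cong (c * f x +_) (sumList-* c f xs)) (sym (*-distribˡ-+ c (f x) _))

  sumList-concatMap : ∀ (f : B → ℕ) (F : A → List B) xs →
                      sumList f (concatMap F xs) ≡ sumList (sumList f ∘ F) xs
  sumList-concatMap f F []       = refl
  sumList-concatMap f F (x ∷ xs) =
    trans (sumList-++ f (F x) (concatMap F xs)) (cong (sumList f (F x) +_) (sumList-concatMap f F xs))

  sumList-upTo : ∀ f n → sumList f (upTo n) ≡ sumBelow f n
  sumList-upTo f zero    = refl
  sumList-upTo f (suc n) = begin
    sumList f (upTo (suc n))          ≡⟨ cong (sumList f) (upTo-∷ʳ n) ⟨
    sumList f (upTo n ++ n ∷ [])      ≡⟨ sumList-++ f (upTo n) (n ∷ []) ⟩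
    sumList f (upTo n) + (f n + 0)    ≡⟨ cong₂ _+_ (sumList-upTo f n) (+-identityʳ (f n)) ⟩
    sumBelow f n + f n                ∎
    where open ≡-Reasoning

  sumBelow-sumList-comm : ∀ (G : ℕ → A → ℕ) xs n →
    sumBelow (λ i → sumList (G i) xs) n ≡ sumList (λ x → sumBelow (λ i → G i x) n) xs
  sumBelow-sumList-comm G []       n = sumBelow-zero n (λ _ _ → refl)
  sumBelow-sumList-comm G (x ∷ xs) n =
    trans (sumBelow-+ (λ i → G i x) (λ i → sumList (G i) xs) n)
          (cong (sumBelow (λ i → G i x) n +_) (sumBelow-sumList-comm G xs n))

  -- simplicial m q = (q + m choose m)
  simplicial : ℕ → ℕ → ℕ
  simplicial zero    q = 1
  simplicial (suc m) q = sumBelow (simplicial m) (suc q)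

  rising : ℕ → ℕ → ℕ
  rising zero    q = 1
  rising (suc k) q = suc q * rising k (suc q)

  rising-suc : ∀ k q → rising (suc k) q ≡ rising k q * (q + suc k)
  rising-suc zero    q = trans (*-identityʳ (suc q)) (trans (+-comm 1 q) (sym (*-identityˡ (q + 1))))
  rising-suc (suc k) q = begin
    suc q * rising (suc k) (suc q)                ≡⟨ cong (suc q *_) (rising-suc k (suc q)) ⟩
    suc q * (rising k (suc q) * (suc q + suc k))  ≡⟨ *-assoc (suc q) (rising k (suc q)) (suc q + suc k) ⟨
    rising (suc k) q * (suc q + suc k)            ≡⟨ cong (rising (suc k) q *_) (+-suc q (suc k)) ⟨
    rising (suc k) q * (q + suc (suc k))          ∎
    where open ≡-Reasoning

  rising-hockeyStick : ∀ m q → rising (suc m) q ≡ suc m * sumBelow (rising m) (suc q)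
  rising-hockeyStick m zero    = trans (rising-suc m 0) (*-comm (rising m 0) (suc m))
  rising-hockeyStick m (suc q) = begin
    rising (suc m) (suc q)
      ≡⟨ rising-suc m (suc q) ⟩
    r * (suc q + suc m)
      ≡⟨ *-distribˡ-+ r (suc q) (suc m) ⟩
    r * suc q + r * suc m
      ≡⟨ cong₂ _+_ (*-comm r (suc q)) (*-comm r (suc m)) ⟩
    rising (suc m) q + suc m * r
      ≡⟨ cong (_+ suc m * r) (rising-hockeyStick m q) ⟩
    suc m * sumBelow (rising m) (suc q) + suc m * r
      ≡⟨ *-distribˡ-+ (suc m) (sumBelow (rising m) (suc q)) r ⟨
    suc m * sumBelow (rising m) (suc (suc q))
      ∎
    where
    open ≡-Reasoning
    r = rising m (suc q)

  rising≡!*simplicial : ∀ k q → rising k q ≡ k ! * simplicial k q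
  rising≡!*simplicial zero    q = refl
  rising≡!*simplicial (suc k) q = begin
    rising (suc k) q                                     ≡⟨ rising-hockeyStick k q ⟩
    suc k * sumBelow (rising k) (suc q)                  ≡⟨ cong (suc k *_) (sumBelow-cong (suc q) (λ i _ → rising≡!*simplicial k i)) ⟩
    suc k * sumBelow (λ i → k ! * simplicial k i) (suc q) ≡⟨ cong (suc k *_) (sumBelow-* (k !) (simplicial k) (suc q)) ⟩
    suc k * (k ! * simplicial (suc k) q)                 ≡⟨ *-assoc (suc k) (k !) _ ⟨
    suc k ! * simplicial (suc k) q                       ∎
    where open ≡-Reasoning

  module _ (E : ℕ) .{{_ : NonZero E}} where

    %-≡⇒∣∸ : ∀ a c → a % E ≡ c % E → E ∣ c ∸ a
    %-≡⇒∣∸ a c a≡c = divides (c / E ∸ a / E) (begin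
      c ∸ a                                   ≡⟨ cong₂ _∸_ (m≡m%n+[m/n]*n c E) (m≡m%n+[m/n]*n a E) ⟩
      (c % E + c / E * E) ∸ (a % E + a / E * E) ≡⟨ cong (λ r → (c % E + c / E * E) ∸ (r + a / E * E)) a≡c ⟩
      (c % E + c / E * E) ∸ (c % E + a / E * E) ≡⟨ [m+n]∸[m+o]≡n∸o (c % E) _ _ ⟩
      c / E * E ∸ a / E * E                   ≡⟨ *-distribʳ-∸ E (c / E) (a / E) ⟨
      (c / E ∸ a / E) * E                     ∎)
      where open ≡-Reasoning

    ∣∸⇒%-≡ : ∀ {a c} → a ≤ c → E ∣ c ∸ a → a % E ≡ c % E
    ∣∸⇒%-≡ {a} a≤c E∣c∸a = sym (trans (cong (_% E) (sym (m+[n∸m]≡n a≤c))) (%-remove-+ʳ a E∣c∸a))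

    suc-/-cases : ∀ z → (E ∣ suc z × suc z / E ≡ suc (z / E)) ⊎ (E ∤ suc z × suc z / E ≡ z / E)
    suc-/-cases z with m≤n⇒m<n∨m≡n (m%n<n z E)
    ... | inj₁ 1+r<E = inj₂ (E∤1+z , trans (cong (_/ E) 1+z≡) 1+r+qE/E≡q)
      where
      1+z≡ : suc z ≡ suc (z % E) + z / E * E
      1+z≡ = cong suc (m≡m%n+[m/n]*n z E)
      1+r+qE/E≡q : (suc (z % E) + z / E * E) / E ≡ z / E
      1+r+qE/E≡q = trans (+-distrib-/-∣ʳ (suc (z % E)) (n∣m*n (z / E)))
                         (cong₂ _+_ (m<n⇒m/n≡0 1+r<E) (m*n/n≡m (z / E) E))
      E∤1+z : E ∤ suc z
      E∤1+z E∣1+z = 1+n≢0 (begin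
        suc (z % E)                        ≡⟨ m<n⇒m%n≡m 1+r<E ⟨
        suc (z % E) % E                    ≡⟨ [m+kn]%n≡m%n (suc (z % E)) (z / E) E ⟨
        (suc (z % E) + z / E * E) % E      ≡⟨ cong (_% E) 1+z≡ ⟨
        suc z % E                          ≡⟨ n∣m⇒m%n≡0 (suc z) E E∣1+z ⟩
        0                                  ∎)
        where open ≡-Reasoning
    ... | inj₂ 1+r≡E = inj₁ (divides (suc (z / E)) 1+z≡ , trans (cong (_/ E) 1+z≡) (m*n/n≡m (suc (z / E)) E))
      where
      1+z≡ : suc z ≡ suc (z / E) * E
      1+z≡ = trans (cong suc (m≡m%n+[m/n]*n z E)) (cong (_+ z / E * E) 1+r≡E)

    onMultiples : (ℕ → ℕ) → ℕ → ℕ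
    onMultiples f y = when (E ∣? y) (f (y / E))

    sumBelow-onMultiples : ∀ f z → sumBelow (onMultiples f) (suc z) ≡ sumBelow f (suc (z / E))
    sumBelow-onMultiples f zero = begin
      when (E ∣? 0) (f (0 / E))   ≡⟨ when-yes (E ∣? 0) (E ∣0) ⟩
      f (0 / E)                   ≡⟨ cong f (0/n≡0 E) ⟩
      sumBelow f 1                ≡⟨ cong (λ q → sumBelow f (suc q)) (0/n≡0 E) ⟨
      sumBelow f (suc (0 / E))    ∎
      where open ≡-Reasoning
    sumBelow-onMultiples f (suc z) with suc-/-cases z
    ... | inj₁ (E∣1+z , 1+z/E≡) = begin
      sumBelow (onMultiples f) (suc z) + onMultiples f (suc z)
        ≡⟨ cong₂ _+_ (sumBelow-onMultiples f z) (when-yes (E ∣? suc z) E∣1+z) ⟩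
      sumBelow f (suc (z / E)) + f (suc z / E)
        ≡⟨ cong (λ q → sumBelow f (suc (z / E)) + f q) 1+z/E≡ ⟩
      sumBelow f (suc (suc (z / E)))
        ≡⟨ cong (λ q → sumBelow f (suc q)) 1+z/E≡ ⟨
      sumBelow f (suc (suc z / E))
        ∎
      where open ≡-Reasoning
    ... | inj₂ (E∤1+z , 1+z/E≡) = begin
      sumBelow (onMultiples f) (suc z) + onMultiples f (suc z)
        ≡⟨ cong₂ _+_ (sumBelow-onMultiples f z) (when-no (E ∣? suc z) E∤1+z) ⟩
      sumBelow f (suc (z / E)) + 0
        ≡⟨ +-identityʳ _ ⟩
      sumBelow f (suc (z / E))
        ≡⟨ cong (λ q → sumBelow f (suc q)) 1+z/E≡ ⟨
      sumBelow f (suc (suc z / E))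
        ∎
      where open ≡-Reasoning

    sumBelow-lastDigit : ∀ T z → sumBelow (λ j → when (j ≤? z) (onMultiples T (z ∸ j))) E ≡ T (z / E)
    sumBelow-lastDigit T z = trans (sumBelow-single E (z % E) (m%n<n z E) others) lastDigit
      where
      z∸r≡qE : z ∸ z % E ≡ z / E * E
      z∸r≡qE = trans (cong (_∸ z % E) (m≡m%n+[m/n]*n z E)) (m+n∸m≡n (z % E) (z / E * E))
      lastDigit : when (z % E ≤? z) (onMultiples T (z ∸ z % E)) ≡ T (z / E)
      lastDigit = begin
        when (z % E ≤? z) (onMultiples T (z ∸ z % E)) ≡⟨ when-yes (z % E ≤? z) (m%n≤m z E) ⟩
        onMultiples T (z ∸ z % E)                     ≡⟨ cong (onMultiples T) z∸r≡qE ⟩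
        when (E ∣? z / E * E) (T (z / E * E / E))     ≡⟨ when-yes (E ∣? z / E * E) (n∣m*n (z / E)) ⟩
        T (z / E * E / E)                             ≡⟨ cong T (m*n/n≡m (z / E) E) ⟩
        T (z / E)                                     ∎
        where open ≡-Reasoning
      others : ∀ i → i < E → i ≢ z % E → when (i ≤? z) (onMultiples T (z ∸ i)) ≡ 0
      others i i<E i≢r = when-≡0 (i ≤? z) (λ i≤z →
        when-no (E ∣? z ∸ i) (λ E∣z∸i → i≢r (trans (sym (m<n⇒m%n≡m i<E)) (∣∸⇒%-≡ i≤z E∣z∸i))))

    sumBelow-digit : ∀ T Y n → sumBelow (λ j → when (j + Y ≤? n) (onMultiples T (n ∸ (j + Y)))) E ≡
                               when (Y ≤? n) (T ((n ∸ Y) / E))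
    sumBelow-digit T Y n with Y ≤? n
    ... | no Y≰n  = trans (sumBelow-zero E (λ j _ → when-no (j + Y ≤? n) (λ j+Y≤n → Y≰n (≤-trans (m≤n+m Y j) j+Y≤n))))
                          (sym (when-no (Y ≤? n) Y≰n))
    ... | yes Y≤n = trans (trans (sumBelow-cong E (λ j _ → shift j)) (sumBelow-lastDigit T (n ∸ Y)))
                          (sym (when-yes (Y ≤? n) Y≤n))
      where
      shift : ∀ j → when (j + Y ≤? n) (onMultiples T (n ∸ (j + Y))) ≡ when (j ≤? n ∸ Y) (onMultiples T (n ∸ Y ∸ j))
      shift j = when-cong (j + Y ≤? n) (j ≤? n ∸ Y) (m+n≤o⇒m≤o∸n j) (m≤o∸n⇒m+n≤o j Y≤n)
                  (λ _ → cong (onMultiples T) (trans (cong (n ∸_) (+-comm j Y)) (sym (∸-+-assoc n Y j))))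

  sumBelow-shift : ∀ a x g → sumBelow (λ c → when (a ≤? c) (g (c ∸ a))) (suc x) ≡
                             when (a ≤? x) (sumBelow g (suc (x ∸ a)))
  sumBelow-shift a x g with a ≤? x
  ... | no a≰x  = trans (sumBelow-zero (suc x) (λ c c<1+x → when-no (a ≤? c) (λ a≤c → a≰x (≤-trans a≤c (s≤s⁻¹ c<1+x)))))
                        (sym (when-no (a ≤? x) a≰x))
  ... | yes a≤x = trans (trans (cong (sumBelow (λ c → when (a ≤? c) (g (c ∸ a)))) 1+x≡a+1+[x∸a]) (shiftBy (suc (x ∸ a))))
                        (sym (when-yes (a ≤? x) a≤x))
    where
    1+x≡a+1+[x∸a] : suc x ≡ a + suc (x ∸ a)
    1+x≡a+1+[x∸a] = sym (trans (+-suc a (x ∸ a)) (cong suc (m+[n∸m]≡n a≤x)))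
    shiftBy : ∀ m → sumBelow (λ c → when (a ≤? c) (g (c ∸ a))) (a + m) ≡ sumBelow g m
    shiftBy zero    = sumBelow-zero (a + 0) (λ c c<a+0 → when-no (a ≤? c) (<⇒≱ (subst (c <_) (+-identityʳ a) c<a+0)))
    shiftBy (suc m) = begin
      sumBelow _ (a + suc m)                                      ≡⟨ cong (sumBelow _) (+-suc a m) ⟩
      sumBelow _ (a + m) + when (a ≤? a + m) (g (a + m ∸ a))      ≡⟨ cong₂ _+_ (shiftBy m) (when-yes (a ≤? a + m) (m≤m+n a m)) ⟩
      sumBelow g m + g (a + m ∸ a)                                ≡⟨ cong (λ y → sumBelow g m + g y) (m+n∸m≡n a m) ⟩
      sumBelow g (suc m)                                          ∎
      where open ≡-Reasoning

  sumList-tuples : ∀ (f : List ℕ → ℕ) b bs →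
                   sumList f (tuples (b ∷ bs)) ≡ sumList (λ js → sumBelow (λ j → f (j ∷ js)) b) (tuples bs)
  sumList-tuples f b bs = begin
    sumList f (concatMap (λ j → map (j ∷_) (tuples bs)) (upTo b))
      ≡⟨ sumList-concatMap f (λ j → map (j ∷_) (tuples bs)) (upTo b) ⟩
    sumList (λ j → sumList f (map (j ∷_) (tuples bs))) (upTo b)
      ≡⟨ sumList-upTo _ b ⟩
    sumBelow (λ j → sumList f (map (j ∷_) (tuples bs))) b
      ≡⟨ sumBelow-cong b (λ j _ → cong sum (map-∘ (tuples bs))) ⟨
    sumBelow (λ j → sumList (λ js → f (j ∷ js)) (tuples bs)) b
      ≡⟨ sumBelow-sumList-comm (λ j js → f (j ∷ js)) (tuples bs) b ⟩
    sumList (λ js → sumBelow (λ j → f (j ∷ js)) b) (tuples bs)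
      ∎
    where open ≡-Reasoning

  bounds-suc : ∀ d k → bounds d (suc k) ≡ d ^ suc k ∷ bounds d k
  bounds-suc d k = cong (d ^ suc k ∷_) (trans (map-applyUpTo suc _ k) (sym (map-upTo _ k)))

  ∈-concatMap-map⁻ : ∀ {c} {C : Set c} {g : A → B → C} {F : A → List B} xs {v} →
                     v ∈ concatMap (λ x → map (g x) (F x)) xs → ∃₂ λ x y → x ∈ xs × y ∈ F x × v ≡ g x y
  ∈-concatMap-map⁻ {g = g} {F} xs v∈ with find (∈-concatMap⁻ (λ x → map (g x) (F x)) {xs = xs} v∈)
  ... | x , x∈xs , v∈map with ∈-map⁻ (g x) v∈map
  ... | y , y∈Fx , refl = x , y , x∈xs , y∈Fx , refl

  ∈-concatMap-map⁺ : ∀ {c} {C : Set c} (g : A → B → C) {F : A → List B} {xs x y} →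
                     x ∈ xs → y ∈ F x → g x y ∈ concatMap (λ x → map (g x) (F x)) xs
  ∈-concatMap-map⁺ g {F} x∈xs y∈Fx = ∈-concatMap⁺ (λ x → map (g x) (F x)) (lose x∈xs (∈-map⁺ (g _) y∈Fx))

  weighted-tuples-≤ : ∀ d bs {js} → js ∈ tuples bs → weighted d js ≤ weighted d bs
  weighted-tuples-≤ d []       (here refl) = z≤n
  weighted-tuples-≤ d (b ∷ bs) js∈ with ∈-concatMap-map⁻ (upTo b) js∈
  ... | j , js , j∈ , js∈ , refl = +-mono-≤ (<⇒≤ (∈-upTo⁻ j∈)) (*-monoʳ-≤ d (weighted-tuples-≤ d bs js∈))

  weighted-bounds : ∀ d k → weighted d (bounds d k) ≡ k * d ^ k
  weighted-bounds d zero    = refl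
  weighted-bounds d (suc k) = begin
    weighted d (bounds d (suc k))        ≡⟨ cong (weighted d) (bounds-suc d k) ⟩
    d ^ suc k + d * weighted d (bounds d k) ≡⟨ cong (λ w → d ^ suc k + d * w) (weighted-bounds d k) ⟩
    d ^ suc k + d * (k * d ^ k)          ≡⟨ cong (d ^ suc k +_) (*-assoc d k (d ^ k)) ⟨
    d ^ suc k + d * k * d ^ k            ≡⟨ cong (λ m → d ^ suc k + m * d ^ k) (*-comm d k) ⟩
    d ^ suc k + k * d * d ^ k            ≡⟨ cong (d ^ suc k +_) (*-assoc k d (d ^ k)) ⟩
    suc k * d ^ suc k                    ∎
    where open ≡-Reasoning

  module _ (d : ℕ) .{{_ : NonZero d}} where

    -- the number of d-ary partitions of n with parts at most d ^ k (length-partitionsUpTo)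
    countUpTo : ℕ → ℕ → ℕ
    countUpTo zero    n = 1
    countUpTo (suc k) n = sumBelow (countUpTo k) (suc (n / d))

    -- 1/k! times the summand of the formula for a tuple of weight J
    contribution : ℕ → ℕ → ℕ → ℕ
    contribution k n J = when (J ≤? n) (onMultiples (d ^ k) {{m^n≢0 d k}} (simplicial k) (n ∸ J))

    ≤/⇒*≤ : ∀ {a n} → a ≤ n / d → d * a ≤ n
    ≤/⇒*≤ {a} {n} a≤n/d = ≤-trans (≤-reflexive (*-comm d a)) (≤-trans (*-monoˡ-≤ d a≤n/d) (m/n*n≤m n d))

    *≤⇒≤/ : ∀ {a n} → d * a ≤ n → a ≤ n / d
    *≤⇒≤/ {a} {n} da≤n = ≤-trans (≤-reflexive (sym (m*n/n≡m a d))) (/-monoˡ-≤ d (≤-trans (≤-reflexive (*-comm a d)) da≤n))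

    module _ (k : ℕ) where

      private instance
        d^k≢0 : NonZero (d ^ k)
        d^k≢0 = m^n≢0 d k
        d^1+k≢0 : NonZero (d ^ suc k)
        d^1+k≢0 = m^n≢0 d (suc k)

      when-rescale : ∀ (T : ℕ → ℕ) n a →
        when (a ≤? n / d) (T ((n / d ∸ a) / d ^ k)) ≡ when (d * a ≤? n) (T ((n ∸ d * a) / d ^ suc k))
      when-rescale T n a = when-cong (a ≤? n / d) (d * a ≤? n) ≤/⇒*≤ *≤⇒≤/ (λ _ → cong T (begin
        (n / d ∸ a) / d ^ k         ≡⟨ cong (_/ d ^ k) ([m∸n*o]/o≡m/o∸n n a d) ⟨
        (n ∸ a * d) / d / d ^ k     ≡⟨ cong (λ x → (n ∸ x) / d / d ^ k) (*-comm a d) ⟩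
        (n ∸ d * a) / d / d ^ k     ≡⟨ m/n/o≡m/[n*o] (n ∸ d * a) d (d ^ k) ⟩
        (n ∸ d * a) / d ^ suc k     ∎))
        where open ≡-Reasoning

      contribution-step : ∀ n J → sumBelow (λ c → contribution k c J) (suc (n / d)) ≡
                                 sumBelow (λ j → contribution (suc k) n (j + d * J)) (d ^ suc k)
      contribution-step n J = begin
        sumBelow (λ c → contribution k c J) (suc (n / d))
          ≡⟨ sumBelow-shift J (n / d) (onMultiples (d ^ k) (simplicial k)) ⟩
        when (J ≤? n / d) (sumBelow (onMultiples (d ^ k) (simplicial k)) (suc (n / d ∸ J)))
          ≡⟨ cong (when (J ≤? n / d)) (sumBelow-onMultiples (d ^ k) (simplicial k) (n / d ∸ J)) ⟩
        when (J ≤? n / d) (simplicial (suc k) ((n / d ∸ J) / d ^ k))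
          ≡⟨ when-rescale (simplicial (suc k)) n J ⟩
        when (d * J ≤? n) (simplicial (suc k) ((n ∸ d * J) / d ^ suc k))
          ≡⟨ sumBelow-digit (d ^ suc k) (simplicial (suc k)) (d * J) n ⟨
        sumBelow (λ j → contribution (suc k) n (j + d * J)) (d ^ suc k)
          ∎
        where open ≡-Reasoning

    countUpTo-tuples : ∀ k n → countUpTo k n ≡ sumList (λ js → contribution k n (weighted d js)) (tuples (bounds d k))
    countUpTo-tuples zero    n = sym (trans (+-identityʳ _) (when-yes (1 ∣? n) (1∣ n)))
    countUpTo-tuples (suc k) n = begin
      sumBelow (countUpTo k) (suc (n / d))
        ≡⟨ sumBelow-cong (suc (n / d)) (λ c _ → countUpTo-tuples k c) ⟩
      sumBelow (λ c → sumList (λ js → contribution k c (weighted d js)) (tuples (bounds d k))) (suc (n / d))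
        ≡⟨ sumBelow-sumList-comm (λ c js → contribution k c (weighted d js)) (tuples (bounds d k)) (suc (n / d)) ⟩
      sumList (λ js → sumBelow (λ c → contribution k c (weighted d js)) (suc (n / d))) (tuples (bounds d k))
        ≡⟨ cong sum (map-cong (λ js → contribution-step k n (weighted d js)) (tuples (bounds d k))) ⟩
      sumList (λ js → sumBelow (λ j → contribution (suc k) n (weighted d (j ∷ js))) (d ^ suc k)) (tuples (bounds d k))
        ≡⟨ sumList-tuples (λ js → contribution (suc k) n (weighted d js)) (d ^ suc k) (bounds d k) ⟨
      sumList (λ js → contribution (suc k) n (weighted d js)) (tuples (d ^ suc k ∷ bounds d k))
        ≡⟨ cong (λ bs → sumList (λ js → contribution (suc k) n (weighted d js)) (tuples bs)) (bounds-suc d k) ⟨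
      sumList (λ js → contribution (suc k) n (weighted d js)) (tuples (bounds d (suc k)))
        ∎
      where open ≡-Reasoning

  length-concatMap : ∀ (F : A → List B) xs → length (concatMap F xs) ≡ sumList (length ∘ F) xs
  length-concatMap F []       = refl
  length-concatMap F (x ∷ xs) = trans (length-++ (F x)) (cong (length (F x) +_) (length-concatMap F xs))

  concatMap-unique : ∀ (key : B → A) {F : A → List B} {xs} → Unique xs → (∀ x → Unique (F x)) →
                     (∀ x {v} → v ∈ F x → key v ≡ x) → Unique (concatMap F xs)
  concatMap-unique key {xs = []}         []          _      _      = []
  concatMap-unique key {F} {xs = x ∷ xs} (x∉xs ∷ u) unique keyed =
    Unique.++⁺ (unique x) (concatMap-unique key u unique keyed) disjoint
    where
    disjoint : Disjoint (F x) (concatMap F xs)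
    disjoint (v∈Fx , v∈rest) with find (∈-concatMap⁻ F {xs = xs} v∈rest)
    ... | y , y∈xs , v∈Fy = All.lookup x∉xs y∈xs (trans (sym (keyed x v∈Fx)) (keyed y v∈Fy))

  module _ {p} {P : A → Set p} (P? : Decidable P) where

    All-takeWhile : ∀ xs → All P (takeWhile P? xs)
    All-takeWhile []       = []
    All-takeWhile (x ∷ xs) with P? x
    ... | yes Px = Px ∷ All-takeWhile xs
    ... | no  _  = []

    takeWhile⁺ : ∀ {q} {Q : A → Set q} {xs} → All Q xs → All Q (takeWhile P? xs)
    takeWhile⁺ []                = []
    takeWhile⁺ {xs = x ∷ _} (Qx ∷ Qxs) with P? x
    ... | yes _ = Qx ∷ takeWhile⁺ Qxs
    ... | no  _ = []

    takeWhile-++ : ∀ {xs ys} → All P xs → All (∁ P) ys → takeWhile P? (xs ++ ys) ≡ xs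
    takeWhile-++ {ys = []}     []         []          = refl
    takeWhile-++ {ys = y ∷ ys} []         (¬Py ∷ _) with P? y
    ... | yes Py = contradiction Py ¬Py
    ... | no  _  = refl
    takeWhile-++ {x ∷ xs} (Px ∷ Pxs) ¬Pys with P? x
    ... | yes _   = cong (x ∷_) (takeWhile-++ Pxs ¬Pys)
    ... | no  ¬Px = contradiction Px ¬Px

  module _ {r} {R : A → A → Set r} where

    Linked-++⁻ˡ : ∀ xs {ys} → Linked R (xs ++ ys) → Linked R xs
    Linked-++⁻ˡ []           _         = []
    Linked-++⁻ˡ (x ∷ [])     _         = [-]
    Linked-++⁻ˡ (x ∷ y ∷ xs) (Rxy ∷ l) = Rxy ∷ Linked-++⁻ˡ (y ∷ xs) l

    Linked-++⁻ʳ : ∀ xs {ys} → Linked R (xs ++ ys) → Linked R ys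
    Linked-++⁻ʳ []       l = l
    Linked-++⁻ʳ (x ∷ xs) l = Linked-++⁻ʳ xs (Linked.tail l)

    Linked-replicate : ∀ n {x} → R x x → Linked R (replicate n x)
    Linked-replicate zero          _   = []
    Linked-replicate (suc zero)    _   = [-]
    Linked-replicate (suc (suc n)) Rxx = Rxx ∷ Linked-replicate (suc n) Rxx

  Linked-++-separated : ∀ {m xs ys} → Linked _≥_ xs → Linked _≥_ ys → All (m ≤_) xs → All (_≤ m) ys →
                        Linked _≥_ (xs ++ ys)
  Linked-++-separated []                 lys _            _         = lys
  Linked-++-separated {ys = []}    [-]   _   _            _         = [-]
  Linked-++-separated {ys = y ∷ _} [-]   lys (m≤x ∷ [])   (y≤m ∷ _) = ≤-trans y≤m m≤x ∷ lys
  Linked-++-separated (x≥y ∷ lxs)        lys (_ ∷ m≤xs)   ys≤m      = x≥y ∷ Linked-++-separated lxs lys m≤xs ys≤m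

  sum-replicate-1 : ∀ n → sum (replicate n 1) ≡ n
  sum-replicate-1 zero    = refl
  sum-replicate-1 (suc n) = cong suc (sum-replicate-1 n)

  sum-map-* : ∀ c xs → sum (map (c *_) xs) ≡ c * sum xs
  sum-map-* c []       = sym (*-zeroʳ c)
  sum-map-* c (x ∷ xs) = trans (cong (c * x +_) (sum-map-* c xs)) (sym (*-distribˡ-+ c x (sum xs)))

  ≡replicate-1 : ∀ {xs} → All (1 ≤_) xs → All (_≤ 1) xs → xs ≡ replicate (sum xs) 1
  ≡replicate-1 []             []             = refl
  ≡replicate-1 (1≤x ∷ 1≤xs) (x≤1 ∷ xs≤1) with ≤-antisym x≤1 1≤x
  ... | refl = cong (1 ∷_) (≡replicate-1 1≤xs xs≤1)

  All-≤-sum : ∀ xs → All (_≤ sum xs) xs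
  All-≤-sum []       = []
  All-≤-sum (x ∷ xs) = m≤m+n x (sum xs) ∷ All.map (λ y≤ → ≤-trans y≤ (m≤n+m (sum xs) x)) (All-≤-sum xs)

  sorted-dropWhile-≤1 : ∀ xs → Linked _≥_ xs → All (_≤ 1) (dropWhile (2 ≤?_) xs)
  sorted-dropWhile-≤1 xs sorted =
    headBound (All.all-head-dropWhile (2 ≤?_) xs)
              (Linked-++⁻ʳ (takeWhile (2 ≤?_) xs) (subst (Linked _≥_) (sym (takeWhile++dropWhile (2 ≤?_) xs)) sorted))
    where
    headBound : ∀ {ys} → Maybe.All (∁ (2 ≤_)) (head ys) → Linked _≥_ ys → All (_≤ 1) ys
    headBound {[]}     _          _       = []
    headBound {y ∷ ys} (just y≱2) sorted′ =
      Linked.Linked⇒All (λ x≥y y≥z → ≤-trans y≥z x≥y) (s≤s⁻¹ (≰⇒> y≱2)) sorted′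

  2≤⇒nonZero : ∀ {d} → 2 ≤ d → NonZero d
  2≤⇒nonZero 2≤d = >-nonZero (≤-trans (s≤s z≤n) 2≤d)

  module _ (d : ℕ) (2≤d : 2 ≤ d) where

    private instance
      d≢0 : NonZero d
      d≢0 = 2≤⇒nonZero 2≤d

    IsDAryPartitionUpTo : ℕ → ℕ → List ℕ → Set
    IsDAryPartitionUpTo k n λs = IsDAryPartition d n λs × All (_≤ d ^ k) λs

    scaleAndFill : ℕ → ℕ → List ℕ → List ℕ
    scaleAndFill n c p = map (d *_) p ++ replicate (n ∸ d * c) 1

    partitionsUpTo : ℕ → ℕ → List (List ℕ)
    partitionsUpTo zero    n = replicate n 1 ∷ []
    partitionsUpTo (suc k) n = concatMap (λ c → map (scaleAndFill n c) (partitionsUpTo k c)) (upTo (suc (n / d)))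

    deflate : List ℕ → List ℕ
    deflate λs = map (_/ d) (takeWhile (2 ≤?_) λs)

    d*m/d≡m : ∀ m → d * m / d ≡ m
    d*m/d≡m m = trans (cong (_/ d) (*-comm d m)) (m*n/n≡m m d)

    power-/ : ∀ {x} → IsPowerOf d x → 2 ≤ x → IsPowerOf d (x / d) × d * (x / d) ≡ x
    power-/ (zero  , refl) (s≤s ())
    power-/ (suc e , refl) _ = (e , d*m/d≡m (d ^ e)) , cong (d *_) (d*m/d≡m (d ^ e))

    power-positive : ∀ {x} → IsPowerOf d x → 1 ≤ x
    power-positive (e , refl) = m^n>0 d e

    power-≤ : ∀ {x k} → IsPowerOf d x → x < d ^ suc k → x ≤ d ^ k
    power-≤ {k = k} (e , refl) d^e<d^1+k with e ≤? k
    ... | yes e≤k = ^-monoʳ-≤ d e≤k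
    ... | no  e≰k = contradiction (^-monoʳ-≤ d (≰⇒> e≰k)) (<⇒≱ d^e<d^1+k)

    ones-valid : ∀ n → IsDAryPartitionUpTo 0 n (replicate n 1)
    ones-valid n = ((Linked-replicate n ≤-refl , All.replicate⁺ n ≤-refl , sum-replicate-1 n) , All.replicate⁺ n (0 , refl)) ,
                   All.replicate⁺ n ≤-refl

    scaleAndFill-valid : ∀ {k n c p} → d * c ≤ n → IsDAryPartitionUpTo k c p →
                         IsDAryPartitionUpTo (suc k) n (scaleAndFill n c p)
    scaleAndFill-valid {k} {n} {c} {p} dc≤n (((sorted , positive , sum≡c) , powers) , bounded) =
      ((sorted′ , positive′ , sum≡n) , powers′) , bounded′
      where
      scaled≥2 : All (2 ≤_) (map (d *_) p)
      scaled≥2 = All.map⁺ (All.map (*-mono-≤ 2≤d) positive)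
      sorted′ = Linked-++-separated (Linked.map⁺ (Linked.map (*-monoʳ-≤ d) sorted)) (Linked-replicate (n ∸ d * c) ≤-refl)
                                    scaled≥2 (All.replicate⁺ (n ∸ d * c) (s≤s z≤n))
      positive′ = All.++⁺ (All.map (≤-trans (s≤s z≤n)) scaled≥2) (All.replicate⁺ (n ∸ d * c) ≤-refl)
      sum≡n = begin
        sum (map (d *_) p ++ replicate (n ∸ d * c) 1)      ≡⟨ sum-++ (map (d *_) p) _ ⟩
        sum (map (d *_) p) + sum (replicate (n ∸ d * c) 1) ≡⟨ cong₂ _+_ (trans (sum-map-* d p) (cong (d *_) sum≡c))
                                                                        (sum-replicate-1 _) ⟩
        d * c + (n ∸ d * c)                                ≡⟨ m+[n∸m]≡n dc≤n ⟩
        n                                                  ∎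
        where open ≡-Reasoning
      powers′ = All.++⁺ (All.map⁺ (All.map (λ { (e , refl) → suc e , refl }) powers)) (All.replicate⁺ (n ∸ d * c) (0 , refl))
      bounded′ = All.++⁺ (All.map⁺ (All.map (*-monoʳ-≤ d) bounded)) (All.replicate⁺ (n ∸ d * c) (m^n>0 d (suc k)))

    deflate-scaleAndFill : ∀ n c {p} → All (1 ≤_) p → deflate (scaleAndFill n c p) ≡ p
    deflate-scaleAndFill n c {p} positive = begin
      map (_/ d) (takeWhile (2 ≤?_) (map (d *_) p ++ replicate (n ∸ d * c) 1))
        ≡⟨ cong (map (_/ d)) (takeWhile-++ (2 ≤?_) (All.map⁺ (All.map (*-mono-≤ 2≤d) positive))
                                                (All.replicate⁺ (n ∸ d * c) (λ { (s≤s ()) }))) ⟩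
      map (_/ d) (map (d *_) p)  ≡⟨ map-∘ p ⟨
      map (λ x → d * x / d) p    ≡⟨ map-id-local (All.tabulate (λ {x} _ → d*m/d≡m x)) ⟩
      p                          ∎
      where open ≡-Reasoning

    decompose : ∀ {k n λs} → IsDAryPartitionUpTo (suc k) n λs →
                d * sum (deflate λs) ≤ n × IsDAryPartitionUpTo k (sum (deflate λs)) (deflate λs) ×
                scaleAndFill n (sum (deflate λs)) (deflate λs) ≡ λs
    decompose {k} {n} {λs} (((sorted , positive , sum≡n) , powers) , bounded) =
      d*c≤n , (((sorted′ , All.map power-positive powers′ , refl) , powers′) , bounded′) , reassembled
      where
      big = takeWhile (2 ≤?_) λs
      ones = dropWhile (2 ≤?_) λs
      p = deflate λs
      c = sum p
      split : big ++ ones ≡ λs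
      split = takeWhile++dropWhile (2 ≤?_) λs
      ones≡ : ones ≡ replicate (sum ones) 1
      ones≡ = ≡replicate-1 (All.dropWhile⁺ (2 ≤?_) positive) (sorted-dropWhile-≤1 λs sorted)
      bigParts : All (λ x → IsPowerOf d (x / d) × d * (x / d) ≡ x) big
      bigParts = All.zipWith (λ (power , ≥2) → power-/ power ≥2) (takeWhile⁺ (2 ≤?_) powers , All-takeWhile (2 ≤?_) λs)
      scaled : map (d *_) p ≡ big
      scaled = trans (sym (map-∘ big)) (map-id-local (All.map proj₂ bigParts))
      n≡ : n ≡ d * c + sum ones
      n≡ = begin
        n                       ≡⟨ trans (sym sum≡n) (cong sum (sym split)) ⟩
        sum (big ++ ones)       ≡⟨ sum-++ big ones ⟩
        sum big + sum ones      ≡⟨ cong (λ b → sum b + sum ones) scaled ⟨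
        sum (map (d *_) p) + sum ones ≡⟨ cong (_+ sum ones) (sum-map-* d p) ⟩
        d * c + sum ones        ∎
        where open ≡-Reasoning
      d*c≤n = ≤-trans (m≤m+n (d * c) (sum ones)) (≤-reflexive (sym n≡))
      sorted′ = Linked.map⁺ (Linked.map (/-monoˡ-≤ d) (Linked-++⁻ˡ big (subst (Linked _≥_) (sym split) sorted)))
      powers′ = All.map⁺ (All.map proj₁ bigParts)
      bounded′ = All.map⁺ (All.map (λ x≤ → ≤-trans (/-monoˡ-≤ d x≤) (≤-reflexive (d*m/d≡m (d ^ k))))
                                   (takeWhile⁺ (2 ≤?_) bounded))
      reassembled : scaleAndFill n c p ≡ λs
      reassembled = begin
        map (d *_) p ++ replicate (n ∸ d * c) 1  ≡⟨ cong₂ (λ b m → b ++ replicate m 1) scaled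
                                                           (trans (cong (_∸ d * c) n≡) (m+n∸m≡n (d * c) (sum ones))) ⟩
        big ++ replicate (sum ones) 1            ≡⟨ cong (big ++_) ones≡ ⟨
        big ++ ones                              ≡⟨ split ⟩
        λs                                       ∎
        where open ≡-Reasoning

    partitionsUpTo-sound : ∀ k n {λs} → λs ∈ partitionsUpTo k n → IsDAryPartitionUpTo k n λs
    partitionsUpTo-sound zero    n (here refl) = ones-valid n
    partitionsUpTo-sound (suc k) n λs∈ with ∈-concatMap-map⁻ (upTo (suc (n / d))) λs∈
    ... | c , p , c∈ , p∈ , refl = scaleAndFill-valid {k} (≤/⇒*≤ d (s≤s⁻¹ (∈-upTo⁻ c∈))) (partitionsUpTo-sound k c p∈)

    partitionsUpTo-complete : ∀ k n {λs} → IsDAryPartitionUpTo k n λs → λs ∈ partitionsUpTo k n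
    partitionsUpTo-complete zero    n {λs} (((_ , positive , sum≡n) , _) , bounded) =
      here (trans (≡replicate-1 positive bounded) (cong (λ m → replicate m 1) sum≡n))
    partitionsUpTo-complete (suc k) n {λs} valid with decompose {k} valid
    ... | d*c≤n , valid′ , reassembled = subst (_∈ partitionsUpTo (suc k) n) reassembled
      (∈-concatMap-map⁺ (scaleAndFill n) (∈-upTo⁺ (s≤s (*≤⇒≤/ d d*c≤n))) (partitionsUpTo-complete k _ valid′))

    partitionsUpTo-unique : ∀ k n → Unique (partitionsUpTo k n)
    partitionsUpTo-unique zero    n = [] ∷ []
    partitionsUpTo-unique (suc k) n =
      concatMap-unique (sum ∘ deflate) (Unique.upTo⁺ (suc (n / d))) block-unique block-key
      where
      positive : ∀ {c p} → p ∈ partitionsUpTo k c → All (1 ≤_) p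
      positive p∈ = proj₁ (proj₂ (proj₁ (proj₁ (partitionsUpTo-sound k _ p∈))))
      block-unique : ∀ c → Unique (map (scaleAndFill n c) (partitionsUpTo k c))
      block-unique c = Unique.map⁻ (subst Unique (sym (begin
        map deflate (map (scaleAndFill n c) (partitionsUpTo k c)) ≡⟨ map-∘ _ ⟨
        map (deflate ∘ scaleAndFill n c) (partitionsUpTo k c)     ≡⟨ map-id-local (All.tabulate (deflate-scaleAndFill n c ∘ positive)) ⟩
        partitionsUpTo k c                                        ∎)) (partitionsUpTo-unique k c))
        where open ≡-Reasoning
      block-key : ∀ c {v} → v ∈ map (scaleAndFill n c) (partitionsUpTo k c) → sum (deflate v) ≡ c
      block-key c v∈ with ∈-map⁻ (scaleAndFill n c) v∈
      ... | p , p∈ , refl = trans (cong sum (deflate-scaleAndFill n c (positive p∈)))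
                                  (proj₂ (proj₂ (proj₁ (proj₁ (partitionsUpTo-sound k c p∈)))))

    length-partitionsUpTo : ∀ k n → length (partitionsUpTo k n) ≡ countUpTo d k n
    length-partitionsUpTo zero    n = refl
    length-partitionsUpTo (suc k) n = begin
      length (concatMap F (upTo (suc (n / d))))  ≡⟨ length-concatMap F (upTo (suc (n / d))) ⟩
      sumList (length ∘ F) (upTo (suc (n / d)))  ≡⟨ sumList-upTo (length ∘ F) (suc (n / d)) ⟩
      sumBelow (length ∘ F) (suc (n / d))        ≡⟨ sumBelow-cong (suc (n / d)) (λ c _ → length-block c) ⟩
      sumBelow (countUpTo d k) (suc (n / d))     ∎
      where
      open ≡-Reasoning
      F = λ c → map (scaleAndFill n c) (partitionsUpTo k c)
      length-block : ∀ c → length (F c) ≡ countUpTo d k c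
      length-block c = trans (length-map (scaleAndFill n c) (partitionsUpTo k c)) (length-partitionsUpTo k c)

    partitionsUpTo-enumerates : ∀ k n → n < d ^ suc k → ∀ λs → λs ∈ partitionsUpTo k n ⇔ IsDAryPartition d n λs
    partitionsUpTo-enumerates k n n<d^1+k λs =
      mk⇔ (proj₁ ∘ partitionsUpTo-sound k n) (λ π → partitionsUpTo-complete k n (π , partsBounded π))
      where
      partsBounded : IsDAryPartition d n λs → All (_≤ d ^ k) λs
      partsBounded ((_ , _ , sum≡n) , powers) =
        All.zipWith (λ (power , ≤sum) → power-≤ {k = k} power (≤-<-trans ≤sum (subst (_< d ^ suc k) (sym sum≡n) n<d^1+k)))
                    (powers , All-≤-sum λs)

    hasDAryCount-countUpTo : ∀ k n → n < d ^ suc k → HasDAryCount d n (countUpTo d k n)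
    hasDAryCount-countUpTo k n n<d^1+k =
      partitionsUpTo k n , partitionsUpTo-enumerates k n n<d^1+k , partitionsUpTo-unique k n , length-partitionsUpTo k n

  open import Data.Integer as ℤ using (ℤ; +_; -_)
  import Data.Integer.Properties as ℤ
  open import Data.Integer.DivMod using (_/ℕ_)

  sumℤ-filter : ∀ {p} {P : A → Set p} (P? : Decidable P) (t : A → ℤ) (G : A → ℕ) xs →
                (∀ x → x ∈ xs → P x → t x ≡ + G x) → (∀ x → ¬ P x → G x ≡ 0) →
                sumℤ (map t (filter P? xs)) ≡ + sumList G xs
  sumℤ-filter P? t G []       _      _      = refl
  sumℤ-filter P? t G (x ∷ xs) t≡G+ ¬P⇒G≡0 with P? x
  ... | yes Px = trans (cong₂ ℤ._+_ (t≡G+ x (here refl) Px) (sumℤ-filter P? t G xs (λ y → t≡G+ y ∘ there) ¬P⇒G≡0))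
                       (sym (ℤ.pos-+ (G x) (sumList G xs)))
  ... | no ¬Px = trans (sumℤ-filter P? t G xs (λ y → t≡G+ y ∘ there) ¬P⇒G≡0)
                       (cong (λ g → + (g + sumList G xs)) (sym (¬P⇒G≡0 x ¬Px)))

  prodℤ-zero : ∀ (f : A → ℤ) {x} xs → x ∈ xs → f x ≡ + 0 → prodℤ (map f xs) ≡ + 0
  prodℤ-zero f (y ∷ xs) (here refl) fx≡0 = cong (ℤ._* prodℤ (map f xs)) fx≡0
  prodℤ-zero f (y ∷ xs) (there x∈xs) fx≡0 = trans (cong (f y ℤ.*_) (prodℤ-zero f xs x∈xs fx≡0)) (ℤ.*-zeroʳ (f y))

  risingℤ : ℤ → ℕ → ℤ
  risingℤ q k = prodℤ (map (λ ℓ → q ℤ.+ + ℓ) (map suc (upTo k)))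

  risingℤ-+ : ∀ k q → risingℤ (+ q) k ≡ + rising k q
  risingℤ-+ zero    q = refl
  risingℤ-+ (suc k) q = begin
    + (q + 1) ℤ.* prodℤ (map (λ ℓ → + q ℤ.+ + ℓ) (map suc (applyUpTo suc k)))
      ≡⟨ cong (λ ℓs → + (q + 1) ℤ.* prodℤ (map (λ ℓ → + q ℤ.+ + ℓ) (map suc ℓs))) (map-upTo suc k) ⟨
    + (q + 1) ℤ.* prodℤ (map (λ ℓ → + q ℤ.+ + ℓ) (map suc (map suc (upTo k))))
      ≡⟨ cong₂ ℤ._*_ (cong +_ (+-comm q 1)) (shift q (map suc (upTo k))) ⟩
    + suc q ℤ.* risingℤ (+ suc q) k
      ≡⟨ cong (+ suc q ℤ.*_) (risingℤ-+ k (suc q)) ⟩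
    + suc q ℤ.* + rising k (suc q)
      ≡⟨ ℤ.pos-* (suc q) (rising k (suc q)) ⟨
    + rising (suc k) q
      ∎
    where
    open ≡-Reasoning
    shift : ∀ q ℓs → prodℤ (map (λ ℓ → + q ℤ.+ + ℓ) (map suc ℓs)) ≡ prodℤ (map (λ ℓ → + suc q ℤ.+ + ℓ) ℓs)
    shift q []       = refl
    shift q (ℓ ∷ ℓs) = cong₂ ℤ._*_ (cong +_ (+-suc q ℓ)) (shift q ℓs)

  -[m*n]/ℕn≡-m : ∀ m n .{{_ : NonZero n}} → (- + (m * n)) /ℕ n ≡ - + m
  -[m*n]/ℕn≡-m m       zero    {{n≢0}} = ⊥-elim (NonZero.nonZero n≢0)
  -[m*n]/ℕn≡-m zero    n@(suc _)       = cong +_ (0/n≡0 n)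
  -[m*n]/ℕn≡-m (suc m) n@(suc _) with suc m * n % n | m*n%n≡0 (suc m) n
  ... | zero  | _  = cong (-_ ∘ +_) (m*n/n≡m (suc m) n)

  risingℤ-neg : ∀ t k → suc t ≤ k → risingℤ (- + suc t) k ≡ + 0
  risingℤ-neg t k t<k =
    prodℤ-zero (λ ℓ → - + suc t ℤ.+ + ℓ) (map suc (upTo k)) (∈-map⁺ suc (∈-upTo⁺ t<k)) (ℤ.+-inverseˡ (+ suc t))

  module _ (d : ℕ) .{{_ : NonZero d}} (k : ℕ) where

    private instance
      d^k≢0 : NonZero (d ^ k)
      d^k≢0 = m^n≢0 d k

    contribution-incongruent : ∀ n J → J % d ^ k ≢ n % d ^ k → contribution d k n J ≡ 0
    contribution-incongruent n J J≢n = when-≡0 (J ≤? n) (λ J≤n →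
      when-no (d ^ k ∣? n ∸ J) (λ d^k∣n∸J → J≢n (∣∸⇒%-≡ (d ^ k) J≤n d^k∣n∸J)))

    risingℤ-contribution : ∀ n J → J ≤ k * d ^ k → J % d ^ k ≡ n % d ^ k →
                        risingℤ ((+ n ℤ.- + J) /ℕ d ^ k) k ≡ + (k ! * contribution d k n J)
    risingℤ-contribution n J J≤kD J≡n with J ≤? n
    ... | yes J≤n = begin
      risingℤ ((+ n ℤ.- + J) /ℕ d ^ k) k   ≡⟨ cong (λ z → risingℤ (z /ℕ d ^ k) k)
                                                   (trans (ℤ.m-n≡m⊖n n J) (ℤ.⊖-≥ J≤n)) ⟩
      risingℤ (+ ((n ∸ J) / d ^ k)) k      ≡⟨ risingℤ-+ k _ ⟩
      + rising k ((n ∸ J) / d ^ k)         ≡⟨ cong +_ (rising≡!*simplicial k _) ⟩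
      + (k ! * simplicial k ((n ∸ J) / d ^ k)) ≡⟨ cong (λ c → + (k ! * c)) contribution≡ ⟨
      + (k ! * contribution d k n J)          ∎
      where
      open ≡-Reasoning
      contribution≡ : contribution d k n J ≡ simplicial k ((n ∸ J) / d ^ k)
      contribution≡ = trans (when-yes (J ≤? n) J≤n) (when-yes (d ^ k ∣? n ∸ J) (%-≡⇒∣∸ (d ^ k) J n J≡n))
    ... | no J≰n = trans (negative ((J ∸ n) / d ^ k) (sym (m/n*n≡m (%-≡⇒∣∸ (d ^ k) n J (sym J≡n)))))
                         (sym (cong +_ (trans (cong (k ! *_) (when-no (J ≤? n) J≰n)) (*-zeroʳ (k !)))))
      where
      n<J = ≰⇒> J≰n
      negative : ∀ t → J ∸ n ≡ t * d ^ k → risingℤ ((+ n ℤ.- + J) /ℕ d ^ k) k ≡ + 0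
      negative zero    J∸n≡0 = contradiction (subst (0 <_) J∸n≡0 (m<n⇒0<n∸m n<J)) (<-irrefl refl)
      negative (suc t) J∸n≡tD = begin
        risingℤ ((+ n ℤ.- + J) /ℕ d ^ k) k       ≡⟨ cong (λ z → risingℤ (z /ℕ d ^ k) k)
                                                       (trans (ℤ.m-n≡m⊖n n J) (ℤ.⊖-< n<J)) ⟩
        risingℤ ((- + (J ∸ n)) /ℕ d ^ k) k      ≡⟨ cong (λ m → risingℤ ((- + m) /ℕ d ^ k) k) J∸n≡tD ⟩
        risingℤ ((- + (suc t * d ^ k)) /ℕ d ^ k) k ≡⟨ cong (λ z → risingℤ z k) (-[m*n]/ℕn≡-m (suc t) (d ^ k)) ⟩
        risingℤ (- + suc t) k                  ≡⟨ risingℤ-neg t k (*-cancelʳ-≤ (suc t) k (d ^ k) tD≤kD) ⟩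
        + 0                                    ∎
        where
        open ≡-Reasoning
        tD≤kD : suc t * d ^ k ≤ k * d ^ k
        tD≤kD = ≤-trans (≤-reflexive (sym J∸n≡tD)) (≤-trans (m∸n≤m J n) J≤kD)

    k!*countUpTo≡rhsSum : ∀ n (h : 2 ≤ d) → + (k !) ℤ.* + countUpTo d k n ≡ rhsSum d k n h
    k!*countUpTo≡rhsSum n h = sym (begin
      rhsSum d k n h
        ≡⟨ sumℤ-filter (λ js → weighted d js % d ^ k ≟ n % d ^ k) (λ js → risingℤ ((+ n ℤ.- + weighted d js) /ℕ d ^ k) k)
                       (λ js → k ! * contribution d k n (weighted d js)) (tuples (bounds d k)) admissible inadmissible ⟩
      + sumList (λ js → k ! * contribution d k n (weighted d js)) (tuples (bounds d k))
        ≡⟨ cong +_ (sumList-* (k !) (λ js → contribution d k n (weighted d js)) (tuples (bounds d k))) ⟩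
      + (k ! * sumList (λ js → contribution d k n (weighted d js)) (tuples (bounds d k)))
        ≡⟨ cong (λ c → + (k ! * c)) (countUpTo-tuples d k n) ⟨
      + (k ! * countUpTo d k n)
        ≡⟨ ℤ.pos-* (k !) (countUpTo d k n) ⟩
      + (k !) ℤ.* + countUpTo d k n
        ∎)
      where
      open ≡-Reasoning
      admissible : ∀ js → js ∈ tuples (bounds d k) → weighted d js % d ^ k ≡ n % d ^ k →
                   risingℤ ((+ n ℤ.- + weighted d js) /ℕ d ^ k) k ≡ + (k ! * contribution d k n (weighted d js))
      admissible js js∈ = risingℤ-contribution n (weighted d js)
        (≤-trans (weighted-tuples-≤ d (bounds d k) js∈) (≤-reflexive (weighted-bounds d k)))
      inadmissible : ∀ js → weighted d js % d ^ k ≢ n % d ^ k → k ! * contribution d k n (weighted d js) ≡ 0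
      inadmissible js J≢n = trans (cong (k ! *_) (contribution-incongruent n (weighted d js) J≢n)) (*-zeroʳ (k !))


open DAryPartitions using (2≤⇒nonZero; hasDAryCount-countUpTo; k!*countUpTo≡rhsSum)
open import Data.Nat using (ℕ; _≤_; _<_; _^_; _!; suc)
open import Data.Integer using (+_; _*_)
open import Data.Product using (Σ; _×_; _,_)
open import Relation.Binary.PropositionalEquality using (_≡_)

theorem3p5 : (d n k : ℕ) → (h : 2 ≤ d) → 1 ≤ n → 1 ≤ k → n < d ^ suc k →
    Σ ℕ λ p → HasDAryCount d n p × (+ (k !) * + p ≡ rhsSum d k n h)
theorem3p5 d n k h _ _ n<d^1+k =
  _ , hasDAryCount-countUpTo d h k n n<d^1+k , k!*countUpTo≡rhsSum d {{2≤⇒nonZero h}} k n h
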